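{- If $r$ is an ab-ba rotor type, then $UD(r)\equiv DU(r)\equiv r$.
   Context: A rotor type is an infinite periodic sequence $r=(r^{(1)},r^{(2)},\dots)$ of states with fundamental period $|r|$; $r\equiv r'$ means one is obtained from the other by an injective relabeling of states. A two-state rotor type is written over $\{1,2\}$ (convention $r^{(1)}=1$); it is ab-ba if $|r|$ is even and for every $k\ge0$ the pair $r^{(2k+1)},r^{(2k+2)}$ consists of one $1$ and one $2$. Rotor-router dynamics: at each non-target vertex $v$ there is a periodic sequence $e_v^{(1)},e_v^{(2)},\dots$ of out-edges; a particle starts at the source, on its $j$-th visit to $v$ leaves along $e_v^{(j)}$, and whenever it reaches a target it is returned to the source; the hitting sequence is the sequence of targets reached. The compressor for $r$ has non-target vertices $1$ (source), $2,3$ and targets $4,5$. On the $j$-th departure: from vertex $1$ the particle goes to vertex $2$ if $r^{(j)}=1$ and to vertex $3$ if $r^{(j)}=2$; from vertex $2$, in variant $U$ it goes to vertex $1$ if $r^{(j)}=1$ and to target $4$ if $r^{(j)}=2$, in variant $D$ to target $4$ if $r^{(j)}=1$ and to vertex $1$ if $r^{(j)}=2$; from vertex $3$ likewise with target $5$. $UD(r)$ (resp. $DU(r)$) is the hitting sequence with variant $U$ at vertex $2$ and $D$ at vertex $3$ (resp. $D$ at $2$, $U$ at $3$), viewed as a rotor type. -}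

module Defs where

open import Data.Nat using (ℕ; zero; suc; _+_; _*_; _<_)
open import Data.Nat.Properties using ()
open import Data.Fin using (Fin; zero; suc)
open import Data.List using (List; []; _∷_; _++_; take; map; upTo)
open import Data.Maybe using (Maybe; just; nothing)
import Data.Maybe as Maybe
open import Data.Product using (Σ; ∃; ∃-syntax; _×_; _,_; proj₁; proj₂)
open import Data.Sum using (_⊎_)
open import Relation.Binary.PropositionalEquality using (_≡_; _≢_)
open import Function.Definitions using (Injective)
open import Data.Nat.Divisibility using (_∣_)

-- Sequences are 0-indexed: (s j) is the paper's s^(j+1).
-- Two-state rotor types are sequences ℕ → Fin 2, where
-- Fin.zero stands for state 1 and Fin.suc Fin.zero for state 2.

IsPeriod : {A : Set} → (ℕ → A) → ℕ → Set
IsPeriod s p = 0 < p × (∀ j → s (j + p) ≡ s j)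

Periodic : {A : Set} → (ℕ → A) → Set
Periodic s = ∃[ p ] IsPeriod s p

IsFundamentalPeriod : {A : Set} → (ℕ → A) → ℕ → Set
IsFundamentalPeriod s p = IsPeriod s p × (∀ q → IsPeriod s q → p Data.Nat.≤ q)

TwoStateRotorType : (ℕ → Fin 2) → Set
TwoStateRotorType r = Periodic r × r 0 ≡ zero

AbBa : (ℕ → Fin 2) → Set
AbBa r = (∃[ p ] (IsFundamentalPeriod r p × 2 ∣ p))
       × (∀ k → r (2 * k) ≢ r (2 * k + 1))

_≡ᵣ_ : {A B : Set} → (ℕ → A) → (ℕ → B) → Set
_≡ᵣ_ {A} {B} s s' =
    (∃[ f ] (Injective _≡_ _≡_ f × (∀ j → s' j ≡ f (s j))))
  ⊎ (∃[ g ] (Injective _≡_ _≡_ g × (∀ j → s j ≡ g (s' j))))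

-- The compressor.
-- Non-target vertices 1 (source), 2, 3; targets 4, 5 encoded as
-- Fin.zero (target 4) and Fin.suc Fin.zero (target 5).

data Vertex : Set where
  v₁ v₂ v₃ : Vertex

data Variant : Set where
  U D : Variant

-- configuration: current particle position and number of departures
-- made so far from each of the vertices 1, 2, 3
record Config : Set where
  constructor config
  field
    pos : Vertex
    c₁ c₂ c₃ : ℕ

initConfig : Config
initConfig = config v₁ 0 0 0

data Move : Set where
  goto : Vertex → Move
  hit  : Fin 2 → Move

sideMove : Variant → Fin 2 → Fin 2 → Move
sideMove U zero    t = goto v₁
sideMove U (suc _) t = hit t
sideMove D zero    t = hit t
sideMove D (suc _) t = goto v₁

sourceMove : Fin 2 → Move
sourceMove zero    = goto v₂
sourceMove (suc _) = goto v₃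

applyMove : Move → Vertex
applyMove (goto v) = v
applyMove (hit _)  = v₁

hitOf : Move → Maybe (Fin 2)
hitOf (goto _) = nothing
hitOf (hit t)  = just t

step : Variant → Variant → (ℕ → Fin 2) → Config → Config × Maybe (Fin 2)
step a b r (config v₁ c₁ c₂ c₃) =
  let m = sourceMove (r c₁) in config (applyMove m) (suc c₁) c₂ c₃ , hitOf m
step a b r (config v₂ c₁ c₂ c₃) =
  let m = sideMove a (r c₂) zero in config (applyMove m) c₁ (suc c₂) c₃ , hitOf m
step a b r (config v₃ c₁ c₂ c₃) =
  let m = sideMove b (r c₃) (suc zero) in config (applyMove m) c₁ c₂ (suc c₃) , hitOf m

configAt : Variant → Variant → (ℕ → Fin 2) → ℕ → Config
configAt a b r zero    = initConfig
configAt a b r (suc n) = proj₁ (step a b r (configAt a b r n))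

hitsUpTo : Variant → Variant → (ℕ → Fin 2) → ℕ → List (Fin 2)
hitsUpTo a b r zero    = []
hitsUpTo a b r (suc n) =
  hitsUpTo a b r n ++ Maybe.maybe (λ t → t ∷ []) [] (proj₂ (step a b r (configAt a b r n)))

IsHittingSeq : Variant → Variant → (ℕ → Fin 2) → (ℕ → Fin 2) → Set
IsHittingSeq a b r h = ∀ k → ∃[ n ] (take k (hitsUpTo a b r n) ≡ map h (upTo k))

-- Group the walk into rounds of four steps. In round k the particle leaves the source in
-- states r (2k) and r (2k+1), which differ because r is ab-ba, so it visits vertex 2 and
-- vertex 3 once each, both in state r k. The two side vertices carry opposite variants, so
-- exactly one of these visits reaches a target: r k itself when vertex 2 has variant D, the
-- other state when it has variant U. Hence DU(r) = r and UD(r) is r with its states swapped.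
module Submission where

open import Defs
open import Data.Nat using (ℕ; zero; suc; _+_; _*_)
open import Data.Nat.Properties using (*-comm; +-comm; ≤-reflexive)
open import Data.Fin using (Fin; zero; suc; opposite)
open import Data.Fin.Properties using (opposite-involutive)
open import Data.List using (List; []; _++_; [_]; take; map; upTo; applyUpTo; _∷ʳ_)
open import Data.List.Properties
  using (++-assoc; ++-identityʳ; applyUpTo-∷ʳ; length-applyUpTo; map-applyUpTo; take-all)
open import Data.Maybe using (maybe)
open import Data.Product using (∃-syntax; _×_; _,_; proj₂)
open import Data.Sum using (_⊎_; inj₁; inj₂)
open import Data.Empty using (⊥-elim)
open import Function using (_∘_; id)
open import Function.Definitions using (Injective)
open import Relation.Binary.PropositionalEquality
  using (_≡_; _≢_; refl; trans; cong; module ≡-Reasoning)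

≡ᵣ-relabel : {A B : Set} (f : A → B) → Injective _≡_ _≡_ f → (s : ℕ → A) → (f ∘ s) ≡ᵣ s
≡ᵣ-relabel f f-injective s = inj₂ (f , f-injective , λ _ → refl)

opposite-injective : ∀ {n} → Injective _≡_ _≡_ (opposite {n})
opposite-injective {x = x} {y} eq = begin
  x                     ≡⟨ opposite-involutive x ⟨
  opposite (opposite x) ≡⟨ cong opposite eq ⟩
  opposite (opposite y) ≡⟨ opposite-involutive y ⟩
  y                     ∎
  where open ≡-Reasoning

distinct-Fin2 : {x y : Fin 2} → x ≢ y → (x ≡ zero × y ≡ suc zero) ⊎ (x ≡ suc zero × y ≡ zero)
distinct-Fin2 {zero}     {zero}     x≢y = ⊥-elim (x≢y refl)
distinct-Fin2 {zero}     {suc zero} _   = inj₁ (refl , refl)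
distinct-Fin2 {suc zero} {zero}     _   = inj₂ (refl , refl)
distinct-Fin2 {suc zero} {suc zero} x≢y = ⊥-elim (x≢y refl)

++-[]-assoc : {A : Set} (xs ys zs : List A) → (((xs ++ []) ++ ys) ++ []) ++ zs ≡ xs ++ ys ++ zs
++-[]-assoc xs ys zs rewrite ++-identityʳ xs | ++-identityʳ (xs ++ ys) = ++-assoc xs ys zs

abBa-pairs : ∀ {r} → AbBa r → ∀ k → r (k * 2) ≢ r (suc (k * 2))
abBa-pairs {r} (_ , pairs) k eq = pairs k (begin
  r (2 * k)       ≡⟨ cong r (*-comm 2 k) ⟩
  r (k * 2)       ≡⟨ eq ⟩
  r (suc (k * 2)) ≡⟨ cong (r ∘ suc) (*-comm k 2) ⟩
  r (1 + 2 * k)   ≡⟨ cong r (+-comm 1 (2 * k)) ⟩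
  r (2 * k + 1)   ∎)
  where open ≡-Reasoning

isHittingSeq-from-prefixes : ∀ {a b r h} → (∀ k → ∃[ n ] hitsUpTo a b r n ≡ applyUpTo h k) →
  IsHittingSeq a b r h
isHittingSeq-from-prefixes {a} {b} {r} {h} prefix k with prefix k
... | n , hits≡ = n , (begin
  take k (hitsUpTo a b r n) ≡⟨ cong (take k) hits≡ ⟩
  take k (applyUpTo h k)    ≡⟨ take-all k _ (≤-reflexive (length-applyUpTo h k)) ⟩
  applyUpTo h k             ≡⟨ map-applyUpTo id h k ⟨
  map h (upTo k)            ∎)
  where open ≡-Reasoning

dual : Variant → Variant
dual U = D
dual D = U

roundHit : Variant → Fin 2 → Fin 2
roundHit U = opposite
roundHit D = id

hitList : Move → List (Fin 2)
hitList m = maybe [_] [] (hitOf m)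

sideMove-returns : ∀ a x t → applyMove (sideMove a x t) ≡ v₁
sideMove-returns U zero    t = refl
sideMove-returns U (suc _) t = refl
sideMove-returns D zero    t = refl
sideMove-returns D (suc _) t = refl

hitList-sideMove-dual : ∀ a x →
  hitList (sideMove a x zero) ++ hitList (sideMove (dual a) x (suc zero)) ≡ [ roundHit a x ]
hitList-sideMove-dual U zero       = refl
hitList-sideMove-dual U (suc zero) = refl
hitList-sideMove-dual D zero       = refl
hitList-sideMove-dual D (suc zero) = refl

hitList-sideMove-dual′ : ∀ a x →
  hitList (sideMove (dual a) x (suc zero)) ++ hitList (sideMove a x zero) ≡ [ roundHit a x ]
hitList-sideMove-dual′ U zero       = refl
hitList-sideMove-dual′ U (suc zero) = refl
hitList-sideMove-dual′ D zero       = refl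
hitList-sideMove-dual′ D (suc zero) = refl

-- The rewrites must come in the order the walk reads the rotors: each one unblocks the next step.
compressor-round : ∀ a r {n c k} → configAt a (dual a) r n ≡ config v₁ c k k → r c ≢ r (suc c) →
  configAt a (dual a) r (4 + n) ≡ config v₁ (2 + c) (suc k) (suc k)
  × hitsUpTo a (dual a) r (4 + n) ≡ hitsUpTo a (dual a) r n ++ [ roundHit a (r k) ]
compressor-round a r {n} {k = k} start distinct with distinct-Fin2 distinct
... | inj₁ (first , second)
  rewrite start | first | sideMove-returns a (r k) zero
        | second | sideMove-returns (dual a) (r k) (suc zero)
  = refl , trans (++-[]-assoc hits _ _) (cong (hits ++_) (hitList-sideMove-dual a (r k)))
  where hits = hitsUpTo a (dual a) r n
... | inj₂ (first , second)
  rewrite start | first | sideMove-returns (dual a) (r k) (suc zero)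
        | second | sideMove-returns a (r k) zero
  = refl , trans (++-[]-assoc hits _ _) (cong (hits ++_) (hitList-sideMove-dual′ a (r k)))
  where hits = hitsUpTo a (dual a) r n

compressor-rounds : ∀ a {r} → AbBa r → ∀ k →
  configAt a (dual a) r (k * 4) ≡ config v₁ (k * 2) k k
  × hitsUpTo a (dual a) r (k * 4) ≡ applyUpTo (roundHit a ∘ r) k
compressor-rounds a ab zero = refl , refl
compressor-rounds a {r} ab (suc k) with compressor-rounds a ab k
... | start , hits≡ with compressor-round a r {k * 4} start (abBa-pairs ab k)
...   | end , hits≡′ = end , (begin
  hitsUpTo a (dual a) r (4 + k * 4)                     ≡⟨ hits≡′ ⟩
  hitsUpTo a (dual a) r (k * 4) ++ [ roundHit a (r k) ] ≡⟨ cong (_∷ʳ roundHit a (r k)) hits≡ ⟩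
  applyUpTo (roundHit a ∘ r) k ∷ʳ roundHit a (r k)      ≡⟨ applyUpTo-∷ʳ (roundHit a ∘ r) k ⟩
  applyUpTo (roundHit a ∘ r) (suc k)                    ∎)
  where open ≡-Reasoning

isHittingSeq-roundHit : ∀ a {r} → AbBa r → IsHittingSeq a (dual a) r (roundHit a ∘ r)
isHittingSeq-roundHit a ab =
  isHittingSeq-from-prefixes λ k → k * 4 , proj₂ (compressor-rounds a ab k)

corollary7p6 : (r : ℕ → Fin 2) → TwoStateRotorType r → AbBa r →
    (∃[ ud ] ∃[ du ] (IsHittingSeq U D r ud × IsHittingSeq D U r du
                      × ud ≡ᵣ du × du ≡ᵣ r × ud ≡ᵣ r))
corollary7p6 r _ ab =
  opposite ∘ r , r ,
  isHittingSeq-roundHit U ab , isHittingSeq-roundHit D ab ,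
  ≡ᵣ-relabel opposite opposite-injective r ,
  ≡ᵣ-relabel id id r ,
  ≡ᵣ-relabel opposite opposite-injective r
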